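{- There exists a countable non-including family $\mathcal T$ of finitely generated theories (each of the form $Cn(F)$ with $F$ finite) such that there is no default theory $(D,W)$ with $\mathrm{ext}(D,W)=\mathcal T$.
   Context: $\mathcal L$ is the set of formulas of a propositional language over a denumerable set of atoms; $Cn$ denotes propositional consequence, and a theory is a subset of $\mathcal L$ closed under $Cn$. A family $\mathcal T$ of subsets of $\mathcal L$ is non-including if each member is a theory and for all $T,T'\in\mathcal T$, $T\subseteq T'$ implies $T=T'$. A default is an expression $d=\frac{\alpha:\Gamma}{\beta}$ with $\alpha,\beta\in\mathcal L$ and $\Gamma$ a finite subset of $\mathcal L$; write $p(d)=\alpha$, $j(d)=\Gamma$, $c(d)=\beta$. A default theory is a pair $(D,W)$ with $D$ a set of such defaults and $W\subseteq\mathcal L$. For a theory $S$, $d$ is $S$-applicable if $S\not\vdash\neg\gamma$ for every $\gamma\in j(d)$. The reduct $D_S$ is the set of monotone rules $\frac{p(d)}{c(d)}$ for $S$-applicable $d\in D$, and $Cn^{D_S}(W)$ is the set of formulas provable from $W$ in propositional calculus extended by the rules in $D_S$. A theory $S$ is an extension of $(D,W)$ iff $S=Cn^{D_S}(W)$; $\mathrm{ext}(D,W)$ denotes the family of all extensions. -}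

module Defs where

open import Data.Nat using (ℕ)
open import Data.Bool using (Bool; true; false; not; _∧_; _∨_)
open import Data.List using (List)
open import Data.List.Membership.Propositional using (_∈_)
open import Data.Product using (Σ; ∃; _×_; _,_)
open import Data.Empty using (⊥)
open import Relation.Nullary using (¬_)
open import Relation.Binary.PropositionalEquality using (_≡_)

data Formula : Set where
  var  : ℕ → Formula
  ⊥f   : Formula
  ¬f_  : Formula → Formula
  _∧f_ : Formula → Formula → Formula
  _∨f_ : Formula → Formula → Formula
  _⇒f_ : Formula → Formula → Formula

Valuation : Set
Valuation = ℕ → Bool

eval : Valuation → Formula → Bool
eval v (var n)  = v n
eval v ⊥f       = false
eval v (¬f φ)   = not (eval v φ)
eval v (φ ∧f ψ) = eval v φ ∧ eval v ψ
eval v (φ ∨f ψ) = eval v φ ∨ eval v ψ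
eval v (φ ⇒f ψ) = not (eval v φ) ∨ eval v ψ

Tautology : Formula → Set
Tautology φ = (v : Valuation) → eval v φ ≡ true

FSet : Set₁
FSet = Formula → Set

-- Monotone rules α / β, given as a binary relation.
Rules : Set₁
Rules = Formula → Formula → Set

data Der (R : Rules) (W : FSet) : Formula → Set where
  hyp  : ∀ {φ} → W φ → Der R W φ
  taut : ∀ {φ} → Tautology φ → Der R W φ
  mp   : ∀ {φ ψ} → Der R W φ → Der R W (φ ⇒f ψ) → Der R W ψ
  rule : ∀ {α β} → R α β → Der R W α → Der R W β

noRules : Rules
noRules _ _ = ⊥

Cn : FSet → FSet
Cn W = Der noRules W

fromList : List Formula → FSet
fromList F φ = φ ∈ F

_⊆_ : FSet → FSet → Set
A ⊆ B = ∀ {φ} → A φ → B φ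

_≐_ : FSet → FSet → Set
A ≐ B = (A ⊆ B) × (B ⊆ A)

IsTheory : FSet → Set
IsTheory T = Cn T ⊆ T

record Default : Set where
  constructor mkDefault
  field
    pre  : Formula
    just : List Formula
    con  : Formula
open Default public

DSet : Set₁
DSet = Default → Set

Applicable : FSet → Default → Set
Applicable S d = ∀ {γ} → γ ∈ just d → ¬ Cn S (¬f γ)

Reduct : DSet → FSet → Rules
Reduct D S α β = Σ Default λ d → D d × Applicable S d × pre d ≡ α × con d ≡ β

IsExtension : DSet → FSet → FSet → Set
IsExtension D W S = IsTheory S × (S ≐ Der (Reduct D S) W)

Family : Set
Family = ℕ → List Formula

member : Family → ℕ → FSet
member F n = Cn (fromList (F n))

InFamily : Family → FSet → Set
InFamily F S = ∃ λ n → S ≐ member F n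

-- Non-including (each member Cn(F n) is automatically a theory)
NonIncluding : Family → Set
NonIncluding F = ∀ m n → member F m ⊆ member F n → member F n ⊆ member F m

ExtEquals : DSet → FSet → Family → Set₁
ExtEquals D W F = (S : FSet) → (IsExtension D W S → InFamily F S) × (InFamily F S → IsExtension D W S)

module Submission where

open import Defs
open import Data.Bool using (true; not; _∧_; _∨_; if_then_else_)
open import Data.List using ([]; _∷_; map)
open import Data.List.Extrema.Nat using (max; xs≤max)
open import Data.List.Membership.Propositional using (_∈_)
open import Data.List.Relation.Unary.All using (lookup)
open import Data.List.Relation.Unary.All.Properties using (map⁻)
open import Data.List.Relation.Unary.Any using (here)
open import Data.Nat using (ℕ; suc; _⊔_; _≤_; _<_; _≟_; _<?_)
open import Data.Nat.Properties
  using (≤-trans; m≤m⊔n; m≤n⊔m; m⊔n≤o⇒m≤o; m⊔n≤o⇒n≤o; n≤1+n; <-irrefl; 0≢1+n)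
open import Function using (case_of_)
open import Data.Product using (Σ; ∃; _×_; _,_; proj₁; proj₂)
open import Relation.Nullary using (¬_; does; yes; no)
open import Relation.Nullary.Decidable using (dec-true; dec-false)
open import Relation.Binary.PropositionalEquality using (_≡_; refl; cong; cong₂; sym; trans; module ≡-Reasoning)
open ≡-Reasoning

-- The family is {Cn(pₙ) | n ∈ ℕ}. If (D, W) had exactly these extensions, the
-- derivation of p₀ in Cn^{D_S₀}(W) would use finitely many defaults, whose
-- justifications mention only atoms below some N. A justification over those
-- atoms that is consistent with p₀ is consistent outright, hence also with p_{N+1};
-- so the same derivation works in Cn^{D_S}(W) for S = Cn(p_{N+1}), putting p₀ in S.

atoms : Family
atoms n = var n ∷ []

atomBound : Formula → ℕ
atomBound (var k)  = suc k
atomBound ⊥f       = 0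
atomBound (¬f φ)   = atomBound φ
atomBound (φ ∧f ψ) = atomBound φ ⊔ atomBound ψ
atomBound (φ ∨f ψ) = atomBound φ ⊔ atomBound ψ
atomBound (φ ⇒f ψ) = atomBound φ ⊔ atomBound ψ

justBound : Default → ℕ
justBound d = max 0 (map atomBound (just d))

atomBound≤justBound : ∀ {γ} d → γ ∈ just d → atomBound γ ≤ justBound d
atomBound≤justBound d = lookup (map⁻ (xs≤max 0 (map atomBound (just d))))

sound : ∀ {X φ} v → (∀ {ψ} → X ψ → eval v ψ ≡ true) → Cn X φ → eval v φ ≡ true
sound v models (hyp x)  = models x
sound v models (taut t) = t v
sound v models (mp {φ} {ψ} δ ε) with eval v φ | sound v models δ | sound v models ε
... | true | refl | ψ-true = ψ-true
sound v models (rule () _)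

eval-cong-below : ∀ {v w n} φ → atomBound φ ≤ n → (∀ {k} → k < n → v k ≡ w k) →
                  eval v φ ≡ eval w φ
eval-cong-below (var k)  k<n agree = agree k<n
eval-cong-below ⊥f       _   _     = refl
eval-cong-below (¬f φ)   b   agree = cong not (eval-cong-below φ b agree)
eval-cong-below (φ ∧f ψ) b   agree =
  cong₂ _∧_ (eval-cong-below φ (m⊔n≤o⇒m≤o _ _ b) agree) (eval-cong-below ψ (m⊔n≤o⇒n≤o _ _ b) agree)
eval-cong-below (φ ∨f ψ) b   agree =
  cong₂ _∨_ (eval-cong-below φ (m⊔n≤o⇒m≤o _ _ b) agree) (eval-cong-below ψ (m⊔n≤o⇒n≤o _ _ b) agree)
eval-cong-below (φ ⇒f ψ) b   agree =
  cong₂ (λ a c → not a ∨ c) (eval-cong-below φ (m⊔n≤o⇒m≤o _ _ b) agree)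
                            (eval-cong-below ψ (m⊔n≤o⇒n≤o _ _ b) agree)

atom-entails-atom : ∀ {m n} → member atoms n (var m) → m ≡ n
atom-entails-atom {m} {n} pₘ with m ≟ n
... | yes m≡n = m≡n
... | no m≢n = case trans (sym (dec-false (m ≟ n) m≢n)) (sound (λ k → does (k ≟ n)) pₙ-true pₘ) of λ ()
  where
  pₙ-true : ∀ {ψ} → fromList (atoms n) ψ → eval (λ k → does (k ≟ n)) ψ ≡ true
  pₙ-true (here refl) = dec-true (n ≟ n) refl

atoms-nonIncluding : NonIncluding atoms
atoms-nonIncluding m n Sₘ⊆Sₙ with refl ← atom-entails-atom (Sₘ⊆Sₙ (hyp (here refl))) = λ φ → φ

raise : ℕ → Valuation → Valuation
raise n v k = if does (k <? n) then v k else true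

refutable-below⇒tautology : ∀ {n γ} → atomBound γ ≤ n → Cn (member atoms n) (¬f γ) →
                            Tautology (¬f γ)
refutable-below⇒tautology {n} {γ} bound refutation v = begin
  not (eval v γ)           ≡⟨ cong not (eval-cong-below γ bound agree) ⟩
  not (eval (raise n v) γ) ≡⟨ sound (raise n v) (sound (raise n v) pₙ-true) refutation ⟩
  true                     ∎
  where
  agree : ∀ {k} → k < n → v k ≡ raise n v k
  agree {k} k<n rewrite dec-true (k <? n) k<n = refl
  pₙ-true : ∀ {ψ} → fromList (atoms n) ψ → eval (raise n v) ψ ≡ true
  pₙ-true (here refl) rewrite dec-false (n <? n) (<-irrefl refl) = refl

record PreservesApplicability (n : ℕ) (S S′ : FSet) : Set where
  constructor preserving
  field preserve : ∀ {d} → justBound d ≤ n → Applicable S d → Applicable S′ d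
open PreservesApplicability

preservesApplicability-mono : ∀ {m n S S′} → m ≤ n →
                              PreservesApplicability n S S′ → PreservesApplicability m S S′
preservesApplicability-mono m≤n p = preserving λ {d} b → preserve p {d} (≤-trans b m≤n)

atoms-preservesApplicability : ∀ n → PreservesApplicability n (member atoms 0) (member atoms n)
atoms-preservesApplicability n = preserving λ {d} b applicable γ∈ refutation →
  applicable γ∈ (taut (refutable-below⇒tautology (≤-trans (atomBound≤justBound d γ∈) b) refutation))

-- A derivation uses finitely many defaults, so it survives any change of the
-- context theory that keeps the defaults with small justifications applicable.
reduct-compact : ∀ {D W S φ} → Der (Reduct D S) W φ →
                 ∃ λ n → ∀ {S′} → PreservesApplicability n S S′ → Der (Reduct D S′) W φ
reduct-compact (hyp w)  = 0 , λ _ → hyp w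
reduct-compact (taut t) = 0 , λ _ → taut t
reduct-compact (mp δ ε) with reduct-compact δ | reduct-compact ε
... | m , δ′ | n , ε′ = m ⊔ n , λ preserves →
  mp (δ′ (preservesApplicability-mono (m≤m⊔n m n) preserves))
     (ε′ (preservesApplicability-mono (m≤n⊔m m n) preserves))
reduct-compact (rule (d , d∈D , applicable , refl , refl) δ) with reduct-compact δ
... | n , δ′ = justBound d ⊔ n , λ preserves →
  rule (d , d∈D , preserve preserves {d} (m≤m⊔n _ n) applicable , refl , refl)
       (δ′ (preservesApplicability-mono (m≤n⊔m _ n) preserves))

mainTheorem4 : Σ Family λ F → NonIncluding F × ((D : DSet) (W : FSet) → ¬ ExtEquals D W F)
mainTheorem4 = atoms , atoms-nonIncluding , no-default-theory
  where
  no-default-theory : (D : DSet) (W : FSet) → ¬ ExtEquals D W atoms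
  no-default-theory D W ext = 0≢1+n (atom-entails-atom p₀∈S)
    where
    extension : ∀ n → IsExtension D W (member atoms n)
    extension n = proj₂ (ext (member atoms n)) (n , (λ φ → φ) , (λ φ → φ))
    p₀-derivation : Der (Reduct D (member atoms 0)) W (var 0)
    p₀-derivation = proj₁ (proj₂ (extension 0)) (hyp (here refl))
    N : ℕ
    N = proj₁ (reduct-compact p₀-derivation)
    p₀∈S : member atoms (suc N) (var 0)
    p₀∈S = proj₂ (proj₂ (extension (suc N)))
      (proj₂ (reduct-compact p₀-derivation)
        (preservesApplicability-mono (n≤1+n N) (atoms-preservesApplicability (suc N))))
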